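{- Let $n\ge 1$ and $k\ge 0$ be integers. Let $\overline{HD}_{n,k-1}$ be the set of pairs $[\sigma,a]$ with $\sigma\in\mathcal{Q}_n$, $\mathrm{des}(\sigma)=k-1$ and $a\in\{1,2,\dots,n\}$. Let $\overline{RHD}_{n+1,k-1}$ be the set of pairs $[\pi,i]$ with $\pi\in\mathcal{Q}_{n+1}$, $\mathrm{des}(\pi)=k-1$, $i\in\{1,\dots,n-k+2\}$ and $i\in\{1,2,\dots,\pi^{ -1}(n+1)-1\}$. Then there is a bijection from $\overline{HD}_{n,k-1}$ onto $\overline{RHD}_{n+1,k-1}$.
   Context: Permutations of $[m]=\{1,\dots,m\}$ are written as words $\pi(1)\cdots\pi(m)$. A descent of $\pi$ is an index $i\in[m-1]$ with $\pi(i)>\pi(i+1)$; $\mathrm{des}(\pi)$ is the number of descents. $\mathcal{Q}_m$ denotes the set of permutations $\pi$ of $[m]$ such that $\pi(1)<\pi(2)<\cdots<\pi(p)$ where $p=\pi^{ -1}(m)$ (the identity permutation being included). -}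

module Defs where

open import Data.Nat using (ℕ; zero; suc; _+_; _≤_)
open import Data.Fin as F using (Fin; toℕ; inject₁; fromℕ)
open import Data.Fin.Properties using (_<?_)
open import Data.Fin.Permutation using (Permutation′; _⟨$⟩ʳ_; _⟨$⟩ˡ_)
open import Data.List using (length; filter)
open import Data.List.Base using (allFin)
open import Data.Product using (_×_; _,_)
open import Relation.Binary.Bundles using (Setoid)
open import Relation.Binary.PropositionalEquality using (_≡_; refl; sym; trans)
open import Level using (0ℓ)

-- Convention: a permutation of [m] is a 'Permutation′ m' (bijection Fin m ↔ Fin m);
-- position/value j : Fin m stands for the integer toℕ j + 1 ∈ [m].

des : ∀ {m} → Permutation′ m → ℕ
des {zero}  π = 0
des {suc m} π = length (filter (λ i → (π ⟨$⟩ʳ F.suc i) <? (π ⟨$⟩ʳ inject₁ i)) (allFin m))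

-- π ∈ Q_m : π(1) < π(2) < ... < π(p) where p = π⁻¹(m)
-- (for every position p carrying the value m, π is increasing on positions 1..p)
InQ : ∀ {m} → Permutation′ m → Set
InQ {m} π = ∀ (p : Fin m) → suc (toℕ (π ⟨$⟩ʳ p)) ≡ m →
            ∀ (i j : Fin m) → i F.< j → j F.≤ p → (π ⟨$⟩ʳ i) F.< (π ⟨$⟩ʳ j)

_≈ₚ_ : ∀ {m} → Permutation′ m → Permutation′ m → Set
π ≈ₚ ρ = ∀ i → π ⟨$⟩ʳ i ≡ ρ ⟨$⟩ʳ i

-- \overline{HD}_{n,k-1}: pairs [σ,a], σ ∈ Q_n, des σ = k-1, a ∈ {1..n}.
-- "des σ = k - 1" (integer subtraction) is written suc (des σ) ≡ k.
record HD (n k : ℕ) : Set where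
  constructor [_,_]⟨_,_,_,_⟩
  field
    σ     : Permutation′ n
    a     : ℕ
    σ∈Q   : InQ σ
    desσ  : suc (des σ) ≡ k
    1≤a   : 1 ≤ a
    a≤n   : a ≤ n

-- \overline{RHD}_{n+1,k-1}: pairs [π,i], π ∈ Q_{n+1}, des π = k-1,
-- i ∈ {1..n-k+2} (written i + k ≤ n + 2) and i ∈ {1..π⁻¹(n+1)-1}.
-- π⁻¹(n+1) (1-indexed) is toℕ (π ⟨$⟩ˡ fromℕ n) + 1, so i ≤ π⁻¹(n+1) - 1 is i ≤ toℕ (π ⟨$⟩ˡ fromℕ n).
record RHD (n k : ℕ) : Set where
  constructor [_,_]⟨_,_,_,_,_⟩
  field
    π     : Permutation′ (suc n)
    i     : ℕ
    π∈Q   : InQ π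
    desπ  : suc (des π) ≡ k
    1≤i   : 1 ≤ i
    i≤    : i + k ≤ n + 2
    i<p   : i ≤ toℕ (π ⟨$⟩ˡ fromℕ n)

HD-setoid : ℕ → ℕ → Setoid 0ℓ 0ℓ
HD-setoid n k = record
  { Carrier = HD n k
  ; _≈_ = λ x y → (HD.σ x ≈ₚ HD.σ y) × (HD.a x ≡ HD.a y)
  ; isEquivalence = record
    { refl = (λ _ → refl) , refl
    ; sym = λ (p , q) → (λ i → sym (p i)) , sym q
    ; trans = λ (p , q) (p' , q') → (λ i → trans (p i) (p' i)) , trans q q' } }

RHD-setoid : ℕ → ℕ → Setoid 0ℓ 0ℓ
RHD-setoid n k = record
  { Carrier = RHD n k
  ; _≈_ = λ x y → (RHD.π x ≈ₚ RHD.π y) × (RHD.i x ≡ RHD.i y)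
  ; isEquivalence = record
    { refl = (λ _ → refl) , refl
    ; sym = λ (p , q) → (λ i → sym (p i)) , sym q
    ; trans = λ (p , q) (p' , q') → (λ i → trans (p i) (p' i)) , trans q q' } }

-- Given σ ∈ Q_n and a ∈ [n], insert the value a into σ at the first position i with σ(i) ≥ a,
-- shifting the values ≥ a up by one; this is 'insert' of Data.Fin.Permutation.  Since
-- σ(i-1) < a ≤ σ(i), the new value neither creates nor destroys a descent, and the positions
-- before the maximum stay free of descents, so the result π lies in Q_{n+1} with des π = des σ.
-- The position i is at most σ⁻¹(n) < π⁻¹(n+1), and i - 1 + des σ ≤ n - 1 because all descents
-- of σ lie after its maximum.  Conversely, deleting the entry at a position i < π⁻¹(n+1) of
-- π ∈ Q_{n+1} gives σ for which a = π(i) is inserted exactly at i, as π increases up to its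
-- maximum; and the insertion position of a is unique.

module Submission where

open import Defs
open import Data.Nat using (ℕ; _≤_)
open import Function.Bundles using (Bijection)

open import Data.Bool.Base using (true; false; if_then_else_)
open import Data.Fin.Base as F using (Fin; toℕ; inject₁; fromℕ; fromℕ<; punchIn; punchOut)
open import Data.Fin.Properties
  using (_<?_; _≟_; toℕ-injective; toℕ-inject; toℕ-inject₁; toℕ-fromℕ; toℕ-fromℕ<; toℕ≤pred[n];
         punchInᵢ≢i; punchIn-injective; punchIn-mono-≤; punchIn-cancel-≤; punchIn-punchOut; ¬∀⟶∃¬-smallest)
open import Data.Fin.Permutation as P using (Permutation; Permutation′; _⟨$⟩ʳ_; _⟨$⟩ˡ_; insert; remove; inverseʳ)
open import Data.List.Base using (length; filter; tabulate)
open import Data.Nat.Base as ℕ using (zero; suc; pred; _+_; _∸_; z≤n; s≤s; z<s; >-nonZero)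
import Data.Nat.Properties as ℕ
open import Data.Product.Base using (∃; _,_; proj₁; proj₂)
open import Function.Base using (id; _∘_)
open import Function.Bundles using (_⇔_; mk⇔; Equivalence; Injection; Inverse)
open import Function.Properties.Inverse using (↔⇒↣; Inverse⇒Bijection)
open import Level using (Level)
open import Relation.Binary.Bundles using (Setoid)
open import Relation.Binary.PropositionalEquality
open import Relation.Nullary.Decidable using (yes; no; does; does-⇔; dec-false)
open import Relation.Nullary.Negation using (¬_; contradiction)
open import Relation.Unary using (Pred; Decidable)

private variable
  ℓ ℓ′ : Level
  A : Set ℓ
  m n : ℕ

open Equivalence using (to; from)

count : {P : Pred (Fin n) ℓ} → Decidable P → ℕ
count {zero}  P? = 0
count {suc n} P? = if does (P? F.zero) then suc (count (P? ∘ F.suc)) else count (P? ∘ F.suc)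

length-filter-tabulate : {P : Pred A ℓ′} (P? : Decidable P) (f : Fin n → A) →
                         length (filter P? (tabulate f)) ≡ count (P? ∘ f)
length-filter-tabulate {n = zero}  P? f = refl
length-filter-tabulate {n = suc n} P? f with does (P? (f F.zero))
... | true  = cong suc (length-filter-tabulate P? (f ∘ F.suc))
... | false = length-filter-tabulate P? (f ∘ F.suc)

count-cong : {P : Pred (Fin n) ℓ} {Q : Pred (Fin n) ℓ′} (P? : Decidable P) (Q? : Decidable Q) →
             (∀ x → P x ⇔ Q x) → count P? ≡ count Q?
count-cong {n = zero}  P? Q? P⇔Q = refl
count-cong {n = suc n} P? Q? P⇔Q =
  cong₂ (λ b c → if b then suc c else c)
        (does-⇔ (P⇔Q F.zero) (P? F.zero) (Q? F.zero))
        (count-cong (P? ∘ F.suc) (Q? ∘ F.suc) (P⇔Q ∘ F.suc))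

count≤n : {P : Pred (Fin n) ℓ} (P? : Decidable P) → count P? ℕ.≤ n
count≤n {n = zero}  P? = z≤n
count≤n {n = suc n} P? with does (P? F.zero)
... | true  = s≤s (count≤n (P? ∘ F.suc))
... | false = ℕ.m≤n⇒m≤1+n (count≤n (P? ∘ F.suc))

count≤n∸k : {P : Pred (Fin n) ℓ} (P? : Decidable P) (k : ℕ) →
            (∀ x → toℕ x ℕ.< k → ¬ P x) → count P? ℕ.≤ n ∸ k
count≤n∸k              P? zero    _  = count≤n P?
count≤n∸k {n = zero}   P? (suc k) _  = z≤n
count≤n∸k {n = suc n}  P? (suc k) ¬P rewrite dec-false (P? F.zero) (¬P F.zero z<s) =
  count≤n∸k (P? ∘ F.suc) k (λ x x<k → ¬P (F.suc x) (s≤s x<k))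

count-punchIn : {P : Pred (Fin (suc n)) ℓ} (P? : Decidable P) (i : Fin (suc n)) →
                ¬ P i → count P? ≡ count (P? ∘ punchIn i)
count-punchIn P? F.zero ¬Pi rewrite dec-false (P? F.zero) ¬Pi = refl
count-punchIn {n = suc n} P? (F.suc i) ¬Pi =
  cong (λ c → if does (P? F.zero) then suc c else c) (count-punchIn (P? ∘ F.suc) i ¬Pi)

toℕ≤toℕ-punchIn : (i : Fin (suc n)) (j : Fin n) → toℕ j ℕ.≤ toℕ (punchIn i j)
toℕ≤toℕ-punchIn F.zero    j         = ℕ.n≤1+n (toℕ j)
toℕ≤toℕ-punchIn (F.suc i) F.zero    = z≤n
toℕ≤toℕ-punchIn (F.suc i) (F.suc j) = s≤s (toℕ≤toℕ-punchIn i j)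

toℕ-punchIn≤suc : (i : Fin (suc n)) (j : Fin n) → toℕ (punchIn i j) ℕ.≤ suc (toℕ j)
toℕ-punchIn≤suc F.zero    j         = ℕ.≤-refl
toℕ-punchIn≤suc (F.suc i) F.zero    = z≤n
toℕ-punchIn≤suc (F.suc i) (F.suc j) = s≤s (toℕ-punchIn≤suc i j)

toℕ-punchIn : (i : Fin (suc n)) (j : Fin n) → i F.≤ j → toℕ (punchIn i j) ≡ suc (toℕ j)
toℕ-punchIn F.zero    j         _         = refl
toℕ-punchIn (F.suc i) (F.suc j) (s≤s i≤j) = cong suc (toℕ-punchIn i j i≤j)

punchInᵢj<i⇔j<i : (i : Fin (suc n)) (j : Fin n) → punchIn i j F.< i ⇔ j F.< i
punchInᵢj<i⇔j<i i j = mk⇔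
  (ℕ.≤-<-trans (toℕ≤toℕ-punchIn i j))
  (λ j<i → ℕ.≤∧≢⇒< (ℕ.≤-trans (toℕ-punchIn≤suc i j) j<i) (punchInᵢ≢i i j ∘ toℕ-injective))

i<punchInᵢj⇔i≤j : (i : Fin (suc n)) (j : Fin n) → i F.< punchIn i j ⇔ i F.≤ j
i<punchInᵢj⇔i≤j i j = mk⇔
  (λ i<punchIn → ℕ.≤-pred (ℕ.<-≤-trans i<punchIn (toℕ-punchIn≤suc i j)))
  (λ i≤j → subst (toℕ i ℕ.<_) (sym (toℕ-punchIn i j i≤j)) (s≤s i≤j))

punchIn-<⇔ : (i : Fin (suc n)) (j k : Fin n) → punchIn i j F.< punchIn i k ⇔ j F.< k
punchIn-<⇔ i j k = mk⇔
  (λ j<k → ℕ.≰⇒> (ℕ.<⇒≱ j<k ∘ punchIn-mono-≤ i k j))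
  (λ j<k → ℕ.≰⇒> (ℕ.<⇒≱ j<k ∘ punchIn-cancel-≤ i k j))

inject₁-punchIn : (i : Fin (suc n)) (j : Fin n) → inject₁ (punchIn i j) ≡ punchIn (inject₁ i) (inject₁ j)
inject₁-punchIn F.zero    j         = refl
inject₁-punchIn (F.suc i) F.zero    = refl
inject₁-punchIn (F.suc i) (F.suc j) = cong F.suc (inject₁-punchIn i j)

suc-punchIn-≢ : (i : Fin (suc n)) (j : Fin n) → suc (toℕ j) ≢ toℕ i →
                F.suc (punchIn i j) ≡ punchIn (inject₁ i) (F.suc j)
suc-punchIn-≢ F.zero            j         _     = refl
suc-punchIn-≢ (F.suc F.zero)    F.zero    j+1≢i = contradiction refl j+1≢i
suc-punchIn-≢ (F.suc (F.suc i)) F.zero    _     = refl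
suc-punchIn-≢ (F.suc i)         (F.suc j) j+1≢i = cong F.suc (suc-punchIn-≢ i j (j+1≢i ∘ cong suc))

suc-punchIn-≡ : (i : Fin (suc n)) (j : Fin n) → suc (toℕ j) ≡ toℕ i → F.suc (punchIn i j) ≡ inject₁ i
suc-punchIn-≡ (F.suc F.zero) F.zero    _     = refl
suc-punchIn-≡ (F.suc i)      (F.suc j) j+1≡i = cong F.suc (suc-punchIn-≡ i j (ℕ.suc-injective j+1≡i))

punchIn-inject₁-self : (i : Fin (suc n)) → punchIn (inject₁ i) i ≡ F.suc i
punchIn-inject₁-self         F.zero    = refl
punchIn-inject₁-self {suc n} (F.suc i) = cong F.suc (punchIn-inject₁-self i)

⟨$⟩ʳ-injective : (ρ : Permutation′ n) {a b : Fin n} → ρ ⟨$⟩ʳ a ≡ ρ ⟨$⟩ʳ b → a ≡ b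
⟨$⟩ʳ-injective ρ = Injection.injective (↔⇒↣ ρ)

∀-punchIn : {P : Pred (Fin (suc n)) ℓ} (i : Fin (suc n)) → P i → (∀ x → P (punchIn i x)) → ∀ y → P y
∀-punchIn {P = P} i Pi P∘punchIn y with i ≟ y
... | yes refl = Pi
... | no  i≢y  = subst P (punchIn-punchOut i≢y) (P∘punchIn (punchOut i≢y))

insert-self : (i : Fin (suc m)) (j : Fin (suc n)) (σ : Permutation m n) → insert i j σ ⟨$⟩ʳ i ≡ j
insert-self i j σ with i ≟ i
... | yes _   = refl
... | no  i≢i = contradiction refl i≢i

insert-cong : (i j : Fin (suc m)) (σ σ′ : Permutation′ m) → σ ≈ₚ σ′ → insert i j σ ≈ₚ insert i j σ′
insert-cong i j σ σ′ σ≈σ′ = ∀-punchIn i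
  (trans (insert-self i j σ) (sym (insert-self i j σ′)))
  (λ x → trans (P.insert-punchIn i j σ x)
         (trans (cong (punchIn j) (σ≈σ′ x)) (sym (P.insert-punchIn i j σ′ x))))

punchIn-remove : (i : Fin (suc m)) (ρ : Permutation′ (suc m)) (x : Fin m) →
                 punchIn (ρ ⟨$⟩ʳ i) (remove i ρ ⟨$⟩ʳ x) ≡ ρ ⟨$⟩ʳ punchIn i x
punchIn-remove i ρ x =
  trans (sym (P.insert-punchIn i (ρ ⟨$⟩ʳ i) (remove i ρ) x)) (P.insert-remove i ρ (punchIn i x))

remove-cong : (i : Fin (suc m)) (ρ ρ′ : Permutation′ (suc m)) → ρ ≈ₚ ρ′ → remove i ρ ≈ₚ remove i ρ′
remove-cong i ρ ρ′ ρ≈ρ′ x = punchIn-injective (ρ ⟨$⟩ʳ i) _ _ (begin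
  punchIn (ρ ⟨$⟩ʳ i) (remove i ρ ⟨$⟩ʳ x)    ≡⟨ punchIn-remove i ρ x ⟩
  ρ ⟨$⟩ʳ punchIn i x                        ≡⟨ ρ≈ρ′ (punchIn i x) ⟩
  ρ′ ⟨$⟩ʳ punchIn i x                       ≡⟨ sym (punchIn-remove i ρ′ x) ⟩
  punchIn (ρ′ ⟨$⟩ʳ i) (remove i ρ′ ⟨$⟩ʳ x)  ≡⟨ cong (λ v → punchIn v _) (sym (ρ≈ρ′ i)) ⟩
  punchIn (ρ ⟨$⟩ʳ i) (remove i ρ′ ⟨$⟩ʳ x)   ∎)
  where open ≡-Reasoning


Descent : Permutation′ (suc m) → Fin m → Set
Descent ρ x = ρ ⟨$⟩ʳ F.suc x F.< ρ ⟨$⟩ʳ inject₁ x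

descent? : (ρ : Permutation′ (suc m)) → Decidable (Descent ρ)
descent? ρ x = ρ ⟨$⟩ʳ F.suc x <? ρ ⟨$⟩ʳ inject₁ x

des≡count-descent : (ρ : Permutation′ (suc m)) → des ρ ≡ count (descent? ρ)
des≡count-descent ρ = length-filter-tabulate (descent? ρ) id

Descent-cong : (ρ ρ′ : Permutation′ (suc m)) → ρ ≈ₚ ρ′ → ∀ x → Descent ρ x → Descent ρ′ x
Descent-cong ρ ρ′ ρ≈ρ′ x = subst₂ F._<_ (ρ≈ρ′ (F.suc x)) (ρ≈ρ′ (inject₁ x))

des-cong : (ρ ρ′ : Permutation′ (suc m)) → ρ ≈ₚ ρ′ → des ρ ≡ des ρ′
des-cong ρ ρ′ ρ≈ρ′ = begin
  des ρ                 ≡⟨ des≡count-descent ρ ⟩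
  count (descent? ρ)    ≡⟨ count-cong (descent? ρ) (descent? ρ′) descent⇔ ⟩
  count (descent? ρ′)   ≡⟨ sym (des≡count-descent ρ′) ⟩
  des ρ′                ∎
  where
  open ≡-Reasoning
  descent⇔ : ∀ x → Descent ρ x ⇔ Descent ρ′ x
  descent⇔ x = mk⇔ (Descent-cong ρ ρ′ ρ≈ρ′ x) (Descent-cong ρ′ ρ (sym ∘ ρ≈ρ′) x)

NoDescentBelow : Permutation′ (suc m) → Fin (suc m) → Set
NoDescentBelow ρ p = ∀ x → x F.< p → ¬ Descent ρ x

noDescentBelow⇒des≤ : (ρ : Permutation′ (suc m)) (p : Fin (suc m)) → NoDescentBelow ρ p → des ρ ℕ.≤ m ∸ toℕ p
noDescentBelow⇒des≤ ρ p noDescent =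
  subst (ℕ._≤ _) (sym (des≡count-descent ρ)) (count≤n∸k (descent? ρ) (toℕ p) noDescent)

top : Permutation′ (suc m) → Fin (suc m)
top {m} ρ = ρ ⟨$⟩ˡ fromℕ m

toℕ-top : (ρ : Permutation′ (suc m)) → toℕ (ρ ⟨$⟩ʳ top ρ) ≡ m
toℕ-top {m} ρ = trans (cong toℕ (inverseʳ ρ)) (toℕ-fromℕ m)

top-unique : (ρ : Permutation′ (suc m)) {p : Fin (suc m)} → toℕ (ρ ⟨$⟩ʳ p) ≡ m → p ≡ top ρ
top-unique ρ ρp≡m = ⟨$⟩ʳ-injective ρ (toℕ-injective (trans ρp≡m (sym (toℕ-top ρ))))

InQ-increasing : (ρ : Permutation′ (suc m)) → InQ ρ → ∀ {a b} → a F.< b → b F.≤ top ρ → ρ ⟨$⟩ʳ a F.< ρ ⟨$⟩ʳ b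
InQ-increasing ρ ρ∈Q = ρ∈Q (top ρ) (cong suc (toℕ-top ρ)) _ _

increasing-from-steps : (f : Fin (suc n) → ℕ) {b : ℕ} →
  (∀ x → toℕ x ℕ.< b → f (inject₁ x) ℕ.< f (F.suc x)) →
  ∀ {i j} → i F.< j → toℕ j ℕ.≤ b → f i ℕ.< f j
increasing-from-steps         f step {F.zero}  {F.suc F.zero}    _         1≤b       = step F.zero 1≤b
increasing-from-steps {suc n} f step {F.zero}  {F.suc (F.suc y)} _         (s≤s j≤b) =
  ℕ.<-trans (step F.zero (s≤s z≤n))
            (increasing-from-steps (f ∘ F.suc) (λ x x<b → step (F.suc x) (s≤s x<b)) {F.zero} {F.suc y} z<s j≤b)
increasing-from-steps {suc n} f step {F.suc i} {F.suc j}         (s≤s i<j) (s≤s j≤b) =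
  increasing-from-steps (f ∘ F.suc) (λ x x<b → step (F.suc x) (s≤s x<b)) i<j j≤b

InQ⇔noDescentBelowTop : (ρ : Permutation′ (suc m)) → InQ ρ ⇔ NoDescentBelow ρ (top ρ)
InQ⇔noDescentBelowTop ρ = mk⇔ InQ⇒ ⇒InQ
  where
  InQ⇒ : InQ ρ → NoDescentBelow ρ (top ρ)
  InQ⇒ ρ∈Q x x<top = ℕ.<-asym (InQ-increasing ρ ρ∈Q (ℕ.≤-reflexive (cong suc (toℕ-inject₁ x))) x<top)
  ⇒InQ : NoDescentBelow ρ (top ρ) → InQ ρ
  ⇒InQ noDescent p ρp≡m i j i<j j≤p rewrite top-unique ρ (ℕ.suc-injective ρp≡m) =
    increasing-from-steps (toℕ ∘ (ρ ⟨$⟩ʳ_)) ascent i<j j≤p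
    where
    ascent : ∀ x → toℕ x ℕ.< toℕ (top ρ) → ρ ⟨$⟩ʳ inject₁ x F.< ρ ⟨$⟩ʳ F.suc x
    ascent x x<top = ℕ.≤∧≢⇒< (ℕ.≮⇒≥ (noDescent x x<top)) (inject₁≢suc ∘ ⟨$⟩ʳ-injective ρ ∘ toℕ-injective)
      where
      inject₁≢suc : inject₁ x ≢ F.suc x
      inject₁≢suc e = ℕ.<-irrefl (trans (sym (toℕ-inject₁ x)) (cong toℕ e)) ℕ.≤-refl

InQ-cong : (ρ ρ′ : Permutation′ n) → ρ ≈ₚ ρ′ → InQ ρ → InQ ρ′
InQ-cong ρ ρ′ ρ≈ρ′ ρ∈Q p ρ′p≡n i j i<j j≤p =
  subst₂ F._<_ (ρ≈ρ′ i) (ρ≈ρ′ j) (ρ∈Q p (trans (cong (suc ∘ toℕ) (ρ≈ρ′ p)) ρ′p≡n) i j i<j j≤p)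

record Fits (σ : Permutation′ n) (i : Fin n) (j : Fin (suc n)) : Set where
  constructor fits
  field
    below : ∀ q → q F.< i → σ ⟨$⟩ʳ q F.< j
    above : j F.≤ σ ⟨$⟩ʳ i
open Fits

fits-≤ : {σ : Permutation′ n} {i p : Fin n} {j : Fin (suc n)} → Fits σ i j → j F.≤ σ ⟨$⟩ʳ p → i F.≤ p
fits-≤ fit j≤σp = ℕ.≮⇒≥ (λ p<i → ℕ.<⇒≱ (below fit _ p<i) j≤σp)

fits-unique : {σ : Permutation′ n} {i i′ : Fin n} {j : Fin (suc n)} → Fits σ i j → Fits σ i′ j → i ≡ i′
fits-unique fit fit′ = toℕ-injective (ℕ.≤-antisym (fits-≤ fit (above fit′)) (fits-≤ fit′ (above fit)))

fits-cong : {σ σ′ : Permutation′ n} {i : Fin n} {j : Fin (suc n)} → σ ≈ₚ σ′ → Fits σ i j → Fits σ′ i j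
fits-cong σ≈σ′ fit = fits
  (λ q q<i → subst (F._< _) (σ≈σ′ q) (below fit q q<i)) (subst (_ F.≤_) (σ≈σ′ _) (above fit))

fits-exists : (σ : Permutation′ n) {p : Fin n} {j : Fin (suc n)} → j F.≤ σ ⟨$⟩ʳ p → ∃ λ i → Fits σ i j
fits-exists {n} σ {p} {j} j≤σp with ¬∀⟶∃¬-smallest n _ (λ q → σ ⟨$⟩ʳ q <? j) (λ all< → ℕ.<⇒≱ (all< p) j≤σp)
... | i , σi≮j , smallest = i , fits below′ (ℕ.≮⇒≥ σi≮j)
  where
  below′ : ∀ q → q F.< i → σ ⟨$⟩ʳ q F.< j
  below′ q q<i = subst (λ r → σ ⟨$⟩ʳ r F.< j) (toℕ-injective (trans (toℕ-inject _) (toℕ-fromℕ< q<i)))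
                       (smallest (fromℕ< q<i))

module Insertion {m : ℕ} (σ : Permutation′ (suc m)) (i : Fin (suc m)) (j : Fin (suc (suc m)))
                 (fit : Fits σ i j) where

  π : Permutation′ (suc (suc m))
  π = insert (inject₁ i) j σ

  π-punchIn : ∀ x → π ⟨$⟩ʳ punchIn (inject₁ i) x ≡ punchIn j (σ ⟨$⟩ʳ x)
  π-punchIn = P.insert-punchIn (inject₁ i) j σ

  π-inject₁-punchIn : ∀ x → π ⟨$⟩ʳ inject₁ (punchIn i x) ≡ punchIn j (σ ⟨$⟩ʳ inject₁ x)
  π-inject₁-punchIn x = trans (cong (π ⟨$⟩ʳ_) (inject₁-punchIn i x)) (π-punchIn (inject₁ x))

  no-descent-at-i : ¬ Descent π i
  no-descent-at-i = ℕ.<-asym (subst₂ F._<_ (sym (insert-self (inject₁ i) j σ)) π-suc-i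
                                         (i<punchInᵢj⇔i≤j j (σ ⟨$⟩ʳ i) .from (above fit)))
    where
    π-suc-i : punchIn j (σ ⟨$⟩ʳ i) ≡ π ⟨$⟩ʳ F.suc i
    π-suc-i = trans (sym (π-punchIn i)) (cong (π ⟨$⟩ʳ_) (punchIn-inject₁-self i))

  descent-punchIn⇔ : ∀ x → Descent π (punchIn i x) ⇔ Descent σ x
  descent-punchIn⇔ x with suc (toℕ x) ℕ.≟ toℕ i
  ... | no x+1≢i = subst₂ (λ a b → a F.< b ⇔ Descent σ x) (sym π-suc) (sym (π-inject₁-punchIn x))
                          (punchIn-<⇔ j (σ ⟨$⟩ʳ F.suc x) (σ ⟨$⟩ʳ inject₁ x))
    where
    π-suc : π ⟨$⟩ʳ F.suc (punchIn i x) ≡ punchIn j (σ ⟨$⟩ʳ F.suc x)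
    π-suc = trans (cong (π ⟨$⟩ʳ_) (suc-punchIn-≢ i x x+1≢i)) (π-punchIn (F.suc x))
  -- the pair x, x+1 straddles the inserted value, and neither permutation descends there
  ... | yes x+1≡i = mk⇔ (λ d → contradiction d ¬descentπ) (λ d → contradiction d ¬descentσ)
    where
    σx<j : σ ⟨$⟩ʳ inject₁ x F.< j
    σx<j = below fit (inject₁ x) (ℕ.≤-reflexive (trans (cong suc (toℕ-inject₁ x)) x+1≡i))
    ¬descentπ : ¬ Descent π (punchIn i x)
    ¬descentπ = ℕ.<-asym (subst₂ F._<_ (sym (π-inject₁-punchIn x)) (sym π-suc)
                                       (punchInᵢj<i⇔j<i j (σ ⟨$⟩ʳ inject₁ x) .from σx<j))
      where
      π-suc : π ⟨$⟩ʳ F.suc (punchIn i x) ≡ j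
      π-suc = trans (cong (π ⟨$⟩ʳ_) (suc-punchIn-≡ i x x+1≡i)) (insert-self (inject₁ i) j σ)
    ¬descentσ : ¬ Descent σ x
    ¬descentσ descent = ℕ.<-irrefl refl (ℕ.<-≤-trans (ℕ.<-trans descent σx<j) j≤σ-suc-x)
      where
      j≤σ-suc-x : j F.≤ σ ⟨$⟩ʳ F.suc x
      j≤σ-suc-x = subst (λ r → j F.≤ σ ⟨$⟩ʳ r) (toℕ-injective (sym x+1≡i)) (above fit)

  des-insert : des π ≡ des σ
  des-insert = begin
    des π                                ≡⟨ des≡count-descent π ⟩
    count (descent? π)                   ≡⟨ count-punchIn (descent? π) i no-descent-at-i ⟩
    count (descent? π ∘ punchIn i)       ≡⟨ count-cong (descent? π ∘ punchIn i) (descent? σ) descent-punchIn⇔ ⟩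
    count (descent? σ)                   ≡⟨ sym (des≡count-descent σ) ⟩
    des σ                                ∎
    where open ≡-Reasoning

  j≤σ-top : j F.≤ σ ⟨$⟩ʳ top σ
  j≤σ-top = ℕ.≤-trans (above fit) (subst (toℕ (σ ⟨$⟩ʳ i) ℕ.≤_) (sym (toℕ-top σ)) (toℕ≤pred[n] (σ ⟨$⟩ʳ i)))

  i≤top : i F.≤ top σ
  i≤top = fits-≤ fit j≤σ-top

  top-insert : top π ≡ punchIn (inject₁ i) (top σ)
  top-insert = sym (top-unique π (begin
    toℕ (π ⟨$⟩ʳ punchIn (inject₁ i) (top σ))  ≡⟨ cong toℕ (π-punchIn (top σ)) ⟩
    toℕ (punchIn j (σ ⟨$⟩ʳ top σ))           ≡⟨ toℕ-punchIn j _ j≤σ-top ⟩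
    suc (toℕ (σ ⟨$⟩ʳ top σ))                 ≡⟨ cong suc (toℕ-top σ) ⟩
    suc m                                    ∎))
    where open ≡-Reasoning

  i<top : i F.< top π
  i<top = subst (toℕ i ℕ.<_) (sym toℕ-topπ) (s≤s i≤top)
    where
    toℕ-topπ : toℕ (top π) ≡ suc (toℕ (top σ))
    toℕ-topπ = trans (cong toℕ top-insert)
                     (toℕ-punchIn (inject₁ i) (top σ) (subst (ℕ._≤ toℕ (top σ)) (sym (toℕ-inject₁ i)) i≤top))

  below-top⇔ : ∀ x → punchIn i x F.< top π ⇔ x F.< top σ
  below-top⇔ x = subst₂ (λ a b → a ℕ.< b ⇔ x F.< top σ) (sym e₁) (sym (cong toℕ top-insert))
                        (subst (λ c → punchIn (inject₁ i) (inject₁ x) F.< punchIn (inject₁ i) (top σ) ⇔ c ℕ.< toℕ (top σ))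
                               (toℕ-inject₁ x) (punchIn-<⇔ (inject₁ i) (inject₁ x) (top σ)))
    where
    e₁ : toℕ (punchIn i x) ≡ toℕ (punchIn (inject₁ i) (inject₁ x))
    e₁ = trans (sym (toℕ-inject₁ (punchIn i x))) (cong toℕ (inject₁-punchIn i x))

  InQ-insert⇔ : InQ π ⇔ InQ σ
  InQ-insert⇔ = mk⇔
    (λ π∈Q → InQ⇔noDescentBelowTop σ .from λ x x<top d →
       InQ⇔noDescentBelowTop π .to π∈Q (punchIn i x) (below-top⇔ x .from x<top) (descent-punchIn⇔ x .from d))
    (λ σ∈Q → InQ⇔noDescentBelowTop π .from (∀-punchIn i (λ _ → no-descent-at-i) λ x y<top d →
       InQ⇔noDescentBelowTop σ .to σ∈Q x (below-top⇔ x .to y<top) (descent-punchIn⇔ x .to d)))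

  index+des≤ : InQ σ → toℕ i + des σ ℕ.≤ m
  index+des≤ σ∈Q = ℕ.≤-trans (ℕ.+-mono-≤ i≤top (noDescentBelow⇒des≤ σ (top σ) (InQ⇔noDescentBelowTop σ .to σ∈Q)))
                             (ℕ.≤-reflexive (ℕ.m+[n∸m]≡n (toℕ≤pred[n] (top σ))))

fits-remove : {π : Permutation′ (suc (suc m))} → InQ π → (i : Fin (suc m)) → i F.< top π →
              Fits (remove (inject₁ i) π) i (π ⟨$⟩ʳ inject₁ i)
fits-remove {π = π} π∈Q i i<top = fits below′ above′
  where
  I = inject₁ i
  σ = remove I π
  j = π ⟨$⟩ʳ I
  I≡i : toℕ I ≡ toℕ i
  I≡i = toℕ-inject₁ i
  below′ : ∀ q → q F.< i → σ ⟨$⟩ʳ q F.< j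
  below′ q q<i = punchInᵢj<i⇔j<i j (σ ⟨$⟩ʳ q) .to (subst (F._< j) (sym (punchIn-remove I π q))
    (InQ-increasing π π∈Q (punchInᵢj<i⇔j<i I q .from (subst (toℕ q ℕ.<_) (sym I≡i) q<i))
                          (ℕ.<⇒≤ (subst (ℕ._< toℕ (top π)) (sym I≡i) i<top))))
  above′ : j F.≤ σ ⟨$⟩ʳ i
  above′ = i<punchInᵢj⇔i≤j j (σ ⟨$⟩ʳ i) .to (subst (j F.<_) (sym (punchIn-remove I π i))
    (subst (λ r → j F.< π ⟨$⟩ʳ r) (sym (punchIn-inject₁-self i))
      (InQ-increasing π π∈Q (ℕ.≤-reflexive (cong suc I≡i)) i<top)))

module Forward {m k : ℕ} (x : HD (suc m) k) where
  open HD x public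

  pred-a≤m : pred a ℕ.≤ m
  pred-a≤m = ℕ.pred-mono-≤ a≤n

  j : Fin (suc (suc m))
  j = fromℕ< (s≤s (ℕ.m≤n⇒m≤1+n pred-a≤m))

  insertion-position : ∃ λ i → Fits σ i j
  insertion-position = fits-exists σ (subst₂ ℕ._≤_ (sym (toℕ-fromℕ< _)) (sym (toℕ-top σ)) pred-a≤m)

  i : Fin (suc m)
  i = proj₁ insertion-position

  fit : Fits σ i j
  fit = proj₂ insertion-position

  open Insertion σ i j fit public

  index-bound : suc (toℕ i) + k ℕ.≤ suc m + 2
  index-bound = subst (λ k → suc (toℕ i) + k ℕ.≤ suc m + 2) desσ (begin
    suc (toℕ i) + suc (des σ)   ≡⟨ cong suc (ℕ.+-suc (toℕ i) (des σ)) ⟩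
    suc (suc (toℕ i + des σ))   ≤⟨ s≤s (s≤s (ℕ.m≤n⇒m≤1+n (index+des≤ σ∈Q))) ⟩
    suc (suc (suc m))           ≡⟨ ℕ.+-comm 2 (suc m) ⟩
    suc m + 2                   ∎)
    where open ℕ.≤-Reasoning

  toRHD : RHD (suc m) k
  toRHD = record
    { π = π ; i = suc (toℕ i) ; π∈Q = InQ-insert⇔ .from σ∈Q ; desπ = trans (cong suc des-insert) desσ
    ; 1≤i = s≤s z≤n ; i≤ = index-bound ; i<p = i<top }

module Backward {m k : ℕ} (y : RHD (suc m) k) where
  open RHD y public

  pred-i<top : pred i ℕ.< toℕ (top π)
  pred-i<top = subst (ℕ._≤ toℕ (top π)) (sym (ℕ.suc-pred i {{>-nonZero 1≤i}})) i<p

  i′ : Fin (suc m)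
  i′ = fromℕ< (ℕ.<-≤-trans pred-i<top (toℕ≤pred[n] (top π)))

  σ : Permutation′ (suc m)
  σ = remove (inject₁ i′) π

  j : Fin (suc (suc m))
  j = π ⟨$⟩ʳ inject₁ i′

  i′<top : i′ F.< top π
  i′<top = subst (ℕ._< toℕ (top π)) (sym (toℕ-fromℕ< _)) pred-i<top

  fit : Fits σ i′ j
  fit = fits-remove {π = π} π∈Q i′ i′<top

  module Ins = Insertion σ i′ j fit

  insert-remove : Ins.π ≈ₚ π
  insert-remove = P.insert-remove (inject₁ i′) π

  a≤n : suc (toℕ j) ℕ.≤ suc m
  a≤n = subst (suc (toℕ j) ℕ.≤_) (toℕ-top π)
          (InQ-increasing π π∈Q (subst (ℕ._< toℕ (top π)) (sym (toℕ-inject₁ i′)) i′<top) ℕ.≤-refl)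

  toHD : HD (suc m) k
  toHD = record
    { σ = σ ; a = suc (toℕ j) ; σ∈Q = Ins.InQ-insert⇔ .to (InQ-cong π Ins.π (sym ∘ insert-remove) π∈Q)
    ; desσ = trans (cong suc (trans (sym Ins.des-insert) (des-cong Ins.π π insert-remove))) desπ
    ; 1≤a = s≤s z≤n ; a≤n = a≤n }

module _ (m k : ℕ) where
  open Setoid (HD-setoid (suc m) k) using () renaming (_≈_ to _≈ᴴ_)
  open Setoid (RHD-setoid (suc m) k) using () renaming (_≈_ to _≈ᴿ_)

  toRHD : HD (suc m) k → RHD (suc m) k
  toRHD = Forward.toRHD

  toHD : RHD (suc m) k → HD (suc m) k
  toHD = Backward.toHD

  toRHD-cong : ∀ {x x′} → x ≈ᴴ x′ → toRHD x ≈ᴿ toRHD x′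
  toRHD-cong {x} {x′} (σ≈σ′ , a≡a′) =
    (λ q → trans (cong₂ (λ i j → insert (inject₁ i) j X.σ ⟨$⟩ʳ q) i≡i′ j≡j′)
                 (insert-cong (inject₁ X′.i) X′.j X.σ X′.σ σ≈σ′ q)) ,
    cong (suc ∘ toℕ) i≡i′
    where
    module X = Forward x
    module X′ = Forward x′
    j≡j′ : X.j ≡ X′.j
    j≡j′ = toℕ-injective (trans (toℕ-fromℕ< _) (trans (cong pred a≡a′) (sym (toℕ-fromℕ< _))))
    i≡i′ : X.i ≡ X′.i
    i≡i′ = fits-unique (fits-cong σ≈σ′ (subst (Fits X.σ X.i) j≡j′ X.fit)) X′.fit

  toHD-cong : ∀ {y y′} → y ≈ᴿ y′ → toHD y ≈ᴴ toHD y′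
  toHD-cong {y} {y′} (π≈π′ , i≡i′) =
    (λ q → trans (cong (λ r → remove (inject₁ r) Y.π ⟨$⟩ʳ q) r≡r′)
                 (remove-cong (inject₁ Y′.i′) Y.π Y′.π π≈π′ q)) ,
    cong (suc ∘ toℕ) (trans (cong (λ r → Y.π ⟨$⟩ʳ inject₁ r) r≡r′) (π≈π′ _))
    where
    module Y = Backward y
    module Y′ = Backward y′
    r≡r′ : Y.i′ ≡ Y′.i′
    r≡r′ = toℕ-injective (trans (toℕ-fromℕ< _) (trans (cong pred i≡i′) (sym (toℕ-fromℕ< _))))

  toHD∘toRHD : ∀ x → toHD (toRHD x) ≈ᴴ x
  toHD∘toRHD x =
    (λ q → trans (cong (λ r → remove (inject₁ r) X.π ⟨$⟩ʳ q) r≡i)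
                 (P.remove-insert (inject₁ X.i) X.j X.σ q)) ,
    (begin
      suc (toℕ (X.π ⟨$⟩ʳ inject₁ Y.i′))  ≡⟨ cong (λ r → suc (toℕ (X.π ⟨$⟩ʳ inject₁ r))) r≡i ⟩
      suc (toℕ (X.π ⟨$⟩ʳ inject₁ X.i))   ≡⟨ cong (suc ∘ toℕ) (insert-self (inject₁ X.i) X.j X.σ) ⟩
      suc (toℕ X.j)                      ≡⟨ cong suc (toℕ-fromℕ< _) ⟩
      suc (pred X.a)                     ≡⟨ ℕ.suc-pred X.a {{>-nonZero X.1≤a}} ⟩
      X.a                                ∎)
    where
    open ≡-Reasoning
    module X = Forward x
    module Y = Backward (toRHD x)
    r≡i : Y.i′ ≡ X.i
    r≡i = toℕ-injective (toℕ-fromℕ< _)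

  toRHD∘toHD : ∀ y → toRHD (toHD y) ≈ᴿ y
  toRHD∘toHD y =
    (λ q → trans (cong₂ (λ i j → insert (inject₁ i) j Y.σ ⟨$⟩ʳ q) i≡r j≡j) (Y.insert-remove q)) ,
    (begin
      suc (toℕ X.i)     ≡⟨ cong (suc ∘ toℕ) i≡r ⟩
      suc (toℕ Y.i′)    ≡⟨ cong suc (toℕ-fromℕ< _) ⟩
      suc (pred Y.i)    ≡⟨ ℕ.suc-pred Y.i {{>-nonZero Y.1≤i}} ⟩
      Y.i               ∎)
    where
    open ≡-Reasoning
    module Y = Backward y
    module X = Forward (toHD y)
    j≡j : X.j ≡ Y.j
    j≡j = toℕ-injective (toℕ-fromℕ< _)
    i≡r : X.i ≡ Y.i′
    i≡r = fits-unique (subst (Fits Y.σ X.i) j≡j X.fit) Y.fit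

  HD↔RHD : Inverse (HD-setoid (suc m) k) (RHD-setoid (suc m) k)
  HD↔RHD = record
    { to        = toRHD
    ; from      = toHD
    ; to-cong   = λ {x} {x′} → toRHD-cong {x} {x′}
    ; from-cong = λ {y} {y′} → toHD-cong {y} {y′}
    ; inverse   = (λ {y} {x} x≈ → R.trans {toRHD x} {toRHD (toHD y)} {y} (toRHD-cong {x} {toHD y} x≈) (toRHD∘toHD y))
                , (λ {x} {y} y≈ → H.trans {toHD y} {toHD (toRHD x)} {x} (toHD-cong {y} {toRHD x} y≈) (toHD∘toRHD x))
    }
    where
    module H = Setoid (HD-setoid (suc m) k)
    module R = Setoid (RHD-setoid (suc m) k)

lemma2p4 : (n k : ℕ) → 1 ≤ n → Bijection (HD-setoid n k) (RHD-setoid n k)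
lemma2p4 (suc m) k _ = Inverse⇒Bijection (HD↔RHD m k)
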